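{- A hypergraph $G$ (all of whose hyperedges have size at least $2$) is a hyperDAG if and only if every induced subgraph of $G$ on a nonempty node set has a node of degree at most $1$.
   Context: Given a DAG $D=(V,A)$, its hyperDAG is the hypergraph on node set $V$ whose hyperedges are the sets $\{u\}\cup S_u$ for each $u\in V$ with $S_u=\{v:(u,v)\in A\}\neq\emptyset$ (hyperedges of size $1$ are omitted). A hypergraph is a hyperDAG if it equals the hyperDAG of some DAG (with the generating nodes of hyperedges not specified). For $V_0\subseteq V$, the subgraph of $G=(V,E)$ induced by $V_0$ has node set $V_0$ and the hyperedges $e\in E$ with $e\subseteq V_0$. The degree of a node is the number of hyperedges containing it. -}

module Defs where

open import Data.Nat using (ℕ; suc; _≤_)
open import Data.Fin using (Fin)
open import Data.Fin.Subset using (Subset; _∈_; _⊆_; _∪_; ⁅_⁆; ∣_∣; Nonempty)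
open import Data.Fin.Subset.Properties using (_∈?_; _⊆?_)
open import Data.List using (List; length; filter)
open import Data.List.Relation.Unary.All using (All)
open import Data.List.Relation.Unary.Unique.Propositional using (Unique)
import Data.List.Membership.Propositional as LM
open import Data.Product using (Σ; _×_; ∃)
open import Relation.Binary.PropositionalEquality using (_≡_)
open import Relation.Nullary using (¬_)
open import Relation.Nullary.Decidable using (_×-dec_)
open import Function.Bundles using (_⇔_)

-- A (finite) hypergraph on node set Fin n: a list of distinct hyperedges
-- (so the list represents a set of hyperedges), each of size at least 2.
record Hypergraph (n : ℕ) : Set where
  field
    edges    : List (Subset n)
    distinct : Unique edges
    size≥2   : All (λ e → 2 ≤ ∣ e ∣) edges
open Hypergraph public

-- A finite directed graph on node set Fin n: out-neighbourhood of each node,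
-- i.e. (u , v) ∈ A  iff  v ∈ out u.
Digraph : ℕ → Set
Digraph n = Fin n → Subset n

data Walk⁺ {n : ℕ} (D : Digraph n) : Fin n → Fin n → Set where
  edge : ∀ {u v} → v ∈ D u → Walk⁺ D u v
  step : ∀ {u v w} → v ∈ D u → Walk⁺ D v w → Walk⁺ D u w

IsDAG : ∀ {n} → Digraph n → Set
IsDAG {n} D = (v : Fin n) → ¬ Walk⁺ D v v

HyperDAGEdge : ∀ {n} → Digraph n → Subset n → Set
HyperDAGEdge {n} D e = Σ (Fin n) λ u → Nonempty (D u) × (e ≡ ⁅ u ⁆ ∪ D u)

IsHyperDAG : ∀ {n} → Hypergraph n → Set
IsHyperDAG {n} G =
  Σ (Digraph n) λ D → IsDAG D × ((e : Subset n) → (e LM.∈ edges G) ⇔ HyperDAGEdge D e)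

inducedDegree : ∀ {n} → Hypergraph n → Subset n → Fin n → ℕ
inducedDegree G V₀ v = length (filter (λ e → (e ⊆? V₀) ×-dec (v ∈? e)) (edges G))

-- Forward: in a DAG every nonempty node set V₀ contains a source s (no arc enters s from V₀);
-- an induced hyperedge containing s is generated by a node of V₀, which cannot be a
-- predecessor of s, so it is the hyperedge {s} ∪ S_s, and s has induced degree at most 1.
-- Backward: peel off a node v of induced degree at most 1 from V₀, orient V₀ - v
-- recursively, and let v point to the rest of its unique induced hyperedge (to nothing if
-- there is none). Every peeled node points only to nodes peeled later, so the result is acyclic.
module Submission where

open import Defs
open import Data.Nat using (ℕ; _≤_)
open import Data.Fin.Subset using (Subset; _∈_; Nonempty)
open import Data.Product using (Σ; _×_)
open import Function.Bundles using (_⇔_)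

open import Data.Nat using (suc; _<_; z≤n; s≤s)
open import Data.Nat.Properties using (≤-trans; <-trans; <-irrefl; ≤-reflexive)
open import Data.Fin using (Fin; _≟_)
open import Data.Fin.Properties using (any?)
open import Data.Fin.Subset using (_∉_; _⊆_; _⊂_; _∪_; _─_; _-_; ⁅_⁆; ∣_∣; ⊥; ⊤; Empty)
open import Data.Fin.Subset.Properties
open import Data.Fin.Subset.Induction using (Acc; acc; ⊂-wellFounded)
open import Data.Vec using (_∷_)
open import Data.Vec.Base using (here; there)
open import Data.Bool using (true; false)
open import Data.Vec.Functional using (updateAt)
open import Data.Vec.Functional.Properties using (updateAt-updates; updateAt-minimal)
open import Data.List using (List; []; _∷_; length; filter)
open import Data.List.Relation.Unary.All as All using (All; _∷_)
open import Data.List.Relation.Unary.Any using (here; there)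
open import Data.List.Relation.Unary.AllPairs using (_∷_)
open import Data.List.Relation.Unary.Unique.Propositional using (Unique)
open import Data.List.Relation.Unary.Unique.Propositional.Properties using (filter⁺)
open import Data.List.Membership.Propositional using () renaming (_∈_ to _∈ₗ_)
open import Data.List.Membership.Propositional.Properties using (∈-filter⁺; ∈-filter⁻)
open import Data.Product using (∃; _,_; proj₂)
open import Data.Sum using (_⊎_; inj₁; inj₂)
open import Data.Empty using (⊥-elim)
open import Function using (_∘_; case_of_)
open import Relation.Binary.Construct.Closure.ReflexiveTransitive using (Star; ε; _◅_; _◅◅_)
open import Relation.Binary.PropositionalEquality using (_≡_; _≢_; refl; sym; trans; cong; subst; subst₂)
open import Relation.Nullary using (¬_; Dec; yes; no)
open import Relation.Nullary.Decidable using (_×-dec_)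
open import Function.Bundles using (mk⇔; Equivalence)

private
  variable
    n : ℕ

x∈p─q⇒x∉q : ∀ {x : Fin n} (p q : Subset n) → x ∈ p ─ q → x ∉ q
x∈p─q⇒x∉q (true ∷ p) (false ∷ q) here      ()
x∈p─q⇒x∉q (_ ∷ p)    (true ∷ q)  (there m) (there h) = x∈p─q⇒x∉q p q m h
x∈p─q⇒x∉q (_ ∷ p)    (false ∷ q) (there m) (there h) = x∈p─q⇒x∉q p q m h

module _ {p : Subset n} {x y : Fin n} where

  x∈p-y⇒x≢y : x ∈ p - y → x ≢ y
  x∈p-y⇒x≢y x∈ refl = x∈p─q⇒x∉q p ⁅ y ⁆ x∈ (x∈⁅x⁆ y)

  x∈p-y⇒x∈p : x ∈ p - y → x ∈ p
  x∈p-y⇒x∈p = p─q⊆p p ⁅ y ⁆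

x∈⁅x⁆∪p : ∀ (x : Fin n) {p} → x ∈ ⁅ x ⁆ ∪ p
x∈⁅x⁆∪p x = x∈p∪q⁺ (inj₁ (x∈⁅x⁆ x))

⁅x⁆∪p-x≡p : ∀ {x : Fin n} {p} → x ∈ p → ⁅ x ⁆ ∪ (p - x) ≡ p
⁅x⁆∪p-x≡p {x = x} {p} x∈p = ⊆-antisym ⊆p p⊆
  where
  ⊆p : ⁅ x ⁆ ∪ (p - x) ⊆ p
  ⊆p y∈ with x∈p∪q⁻ ⁅ x ⁆ (p - x) y∈
  ... | inj₁ y∈⁅x⁆ = subst (_∈ p) (sym (x∈⁅y⁆⇒x≡y x y∈⁅x⁆)) x∈p
  ... | inj₂ y∈p-x = x∈p-y⇒x∈p y∈p-x
  p⊆ : p ⊆ ⁅ x ⁆ ∪ (p - x)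
  p⊆ {y} y∈p with y ≟ x
  ... | yes refl = x∈⁅x⁆∪p y
  ... | no y≢x   = x∈p∪q⁺ (inj₂ (x∈p∧x≢y⇒x∈p-y y∈p y≢x))

Empty⇒∣p∣≡0 : ∀ {p : Subset n} → Empty p → ∣ p ∣ ≡ 0
Empty⇒∣p∣≡0 {n} p∅ = trans (cong ∣_∣ (Empty-unique p∅)) (∣⊥∣≡0 n)

2≤∣p∣⇒Nonempty[p-x] : ∀ {p : Subset n} x → 2 ≤ ∣ p ∣ → Nonempty (p - x)
2≤∣p∣⇒Nonempty[p-x] {p = p} x 2≤∣p∣ with nonempty? (p - x)
... | yes p-x≠∅ = p-x≠∅
... | no  p-x∅  = ⊥-elim (<-irrefl refl (≤-trans 2≤∣p∣ ∣p∣≤1))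
  where
  p⊆⁅x⁆ : p ⊆ ⁅ x ⁆
  p⊆⁅x⁆ {y} y∈p with y ≟ x
  ... | yes refl = x∈⁅x⁆ y
  ... | no y≢x   = ⊥-elim (p-x∅ (y , x∈p∧x≢y⇒x∈p-y y∈p y≢x))
  ∣p∣≤1 : ∣ p ∣ ≤ 1
  ∣p∣≤1 = ≤-trans (p⊆q⇒∣p∣≤∣q∣ p⊆⁅x⁆) (≤-reflexive (∣⁅x⁆∣≡1 x))

Unique∧All≡⇒length≤1 : ∀ {A : Set} {x : A} {xs : List A} → Unique xs → All (_≡ x) xs → length xs ≤ 1
Unique∧All≡⇒length≤1 {xs = []}         _                  _                  = z≤n
Unique∧All≡⇒length≤1 {xs = _ ∷ []}     _                  _                  = s≤s z≤n
Unique∧All≡⇒length≤1 {xs = _ ∷ _ ∷ _} ((y≢z ∷ _) ∷ _) (y≡x ∷ z≡x ∷ _) = ⊥-elim (y≢z (trans y≡x (sym z≡x)))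

module _ {D : Digraph n} where

  Arc : Fin n → Fin n → Set
  Arc u v = v ∈ D u

  ◅⇒Walk⁺ : ∀ {u v w} → Arc u v → Star Arc v w → Walk⁺ D u w
  ◅⇒Walk⁺ u→v ε             = edge u→v
  ◅⇒Walk⁺ u→v (v→x ◅ x⇝w) = step u→v (◅⇒Walk⁺ v→x x⇝w)

  Walk⁺⇒rank< : ∀ (rank : Fin n → ℕ) → (∀ {u v} → Arc u v → rank u < rank v) →
                ∀ {u v} → Walk⁺ D u v → rank u < rank v
  Walk⁺⇒rank< rank ascending (edge u→v)    = ascending u→v
  Walk⁺⇒rank< rank ascending (step u→v w) = <-trans (ascending u→v) (Walk⁺⇒rank< rank ascending w)

  ranked⇒IsDAG : ∀ (rank : Fin n → ℕ) → (∀ {u v} → Arc u v → rank u < rank v) → IsDAG D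
  ranked⇒IsDAG rank ascending v v⇝v = <-irrefl refl (Walk⁺⇒rank< rank ascending v⇝v)

  Source : Subset n → Fin n → Set
  Source V₀ s = s ∈ V₀ × (∀ {w} → w ∈ V₀ → ¬ Arc w s)

  module _ (acyclic : IsDAG D) where

    sourceAbove : ∀ {V₀ u} → Acc _⊂_ V₀ → u ∈ V₀ → ∃ λ s → Source V₀ s × Star Arc s u
    sourceAbove {V₀} {u} (acc smaller) u∈V₀ with any? (λ w → (w ∈? V₀) ×-dec (u ∈? D w))
    ... | no noPred = u , (u∈V₀ , λ w∈V₀ w→u → noPred (_ , w∈V₀ , w→u)) , ε
    ... | yes (w , w∈V₀ , w→u)
      with sourceAbove (smaller (x∈p⇒p-x⊂p u∈V₀))
                       (x∈p∧x≢y⇒x∈p-y w∈V₀ (λ { refl → acyclic w (◅⇒Walk⁺ w→u ε) }))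
    ... | s , (s∈V₀-u , noArcIn) , s⇝w = s , (x∈p-y⇒x∈p s∈V₀-u , noArcIn′) , s⇝u
      where
      s⇝u : Star Arc s u
      s⇝u = s⇝w ◅◅ (w→u ◅ ε)
      noArcIn′ : ∀ {x} → x ∈ V₀ → s ∉ D x
      noArcIn′ {x} x∈V₀ x→s with x ≟ u
      ... | yes refl = acyclic x (◅⇒Walk⁺ x→s s⇝u)
      ... | no x≢u   = noArcIn (x∈p∧x≢y⇒x∈p-y x∈V₀ x≢u) x→s

    source : ∀ {V₀} → Nonempty V₀ → ∃ (Source V₀)
    source {V₀} (u , u∈V₀) with sourceAbove (⊂-wellFounded V₀) u∈V₀
    ... | s , s-source , _ = s , s-source

Degenerate : ℕ → Hypergraph n → Set
Degenerate {n} k G = (V₀ : Subset n) → Nonempty V₀ → Σ (Fin n) λ v → v ∈ V₀ × inducedDegree G V₀ v ≤ k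

module _ (G : Hypergraph n) where

  InducedIncident : Subset n → Fin n → Subset n → Set
  InducedIncident V₀ v e = e ∈ₗ edges G × e ⊆ V₀ × v ∈ e

  contains? : ∀ V₀ v (e : Subset n) → Dec (e ⊆ V₀ × v ∈ e)
  contains? V₀ v e = (e ⊆? V₀) ×-dec (v ∈? e)

  inducedIncident : Subset n → Fin n → List (Subset n)
  inducedIncident V₀ v = filter (contains? V₀ v) (edges G)

  module _ {V₀ : Subset n} {v : Fin n} where

    ∈-inducedIncident⁻ : ∀ {e} → e ∈ₗ inducedIncident V₀ v → InducedIncident V₀ v e
    ∈-inducedIncident⁻ = ∈-filter⁻ (contains? V₀ v) {xs = edges G}

    ∈-inducedIncident⁺ : ∀ {e} → InducedIncident V₀ v e → e ∈ₗ inducedIncident V₀ v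
    ∈-inducedIncident⁺ (e∈G , e⊆V₀ , v∈e) = ∈-filter⁺ (contains? V₀ v) e∈G (e⊆V₀ , v∈e)

    inducedIncident-unique : Unique (inducedIncident V₀ v)
    inducedIncident-unique = filter⁺ (contains? V₀ v) (distinct G)

hyperDAG⇒1-degenerate : (G : Hypergraph n) → IsHyperDAG G → Degenerate 1 G
hyperDAG⇒1-degenerate G (D , acyclic , edge⇔) V₀ V₀≠∅ with source acyclic V₀≠∅
... | s , s∈V₀ , noArcIn =
  s , s∈V₀ , Unique∧All≡⇒length≤1 (inducedIncident-unique G) (All.tabulate generatedByS)
  where
  generatedByS : ∀ {e} → e ∈ₗ inducedIncident G V₀ s → e ≡ ⁅ s ⁆ ∪ D s
  generatedByS e∈ with ∈-inducedIncident⁻ G e∈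
  ... | e∈G , e⊆V₀ , s∈e with Equivalence.to (edge⇔ _) e∈G
  ... | u , _ , refl with x∈p∪q⁻ ⁅ u ⁆ (D u) s∈e
  ... | inj₁ s∈⁅u⁆ rewrite x∈⁅y⁆⇒x≡y u s∈⁅u⁆ = refl
  ... | inj₂ u→s = ⊥-elim (noArcIn (e⊆V₀ (x∈⁅x⁆∪p u)) u→s)

module Orientations (G : Hypergraph n) where

  Spans : Fin n → Subset n → Set
  Spans u S = Empty S ⊎ ⁅ u ⁆ ∪ S ∈ₗ edges G

  -- S is a valid out-neighbourhood for v when v is peeled off V₀.
  record OutSet (V₀ : Subset n) (v : Fin n) (S : Subset n) : Set where
    field
      ⊆-rest : S ⊆ V₀ - v
      spans  : Spans v S
      covers : ∀ {e} → InducedIncident G V₀ v e → Nonempty S × e ≡ ⁅ v ⁆ ∪ S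

  record Orientation (V₀ : Subset n) : Set where
    field
      out       : Digraph n
      rank      : Fin n → ℕ
      ascending : ∀ {u w} → u ∈ V₀ → w ∈ out u → w ∈ V₀ × rank u < rank w
      spans     : ∀ {u} → u ∈ V₀ → Spans u (out u)
      covers    : ∀ {e} → e ∈ₗ edges G → e ⊆ V₀ → HyperDAGEdge out e

  hyperDAGEdge : ∀ {D : Digraph n} {e S} u → D u ≡ S → Nonempty S → e ≡ ⁅ u ⁆ ∪ S → HyperDAGEdge D e
  hyperDAGEdge u refl S≠∅ e≡ = u , S≠∅ , e≡

  edge⊈Empty : ∀ {e V₀} → e ∈ₗ edges G → e ⊆ V₀ → ¬ Empty V₀
  edge⊈Empty e∈G e⊆V₀ V₀∅
    with ≤-trans (All.lookup (size≥2 G) e∈G) (≤-trans (p⊆q⇒∣p∣≤∣q∣ e⊆V₀) (≤-reflexive (Empty⇒∣p∣≡0 V₀∅)))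
  ... | ()

  orientEmpty : ∀ {V₀} → Empty V₀ → Orientation V₀
  orientEmpty V₀∅ = record
    { out       = λ _ → ⊥
    ; rank      = λ _ → 0
    ; ascending = λ u∈V₀ _ → ⊥-elim (V₀∅ (_ , u∈V₀))
    ; spans     = λ u∈V₀ → ⊥-elim (V₀∅ (_ , u∈V₀))
    ; covers    = λ e∈G e⊆V₀ → ⊥-elim (edge⊈Empty e∈G e⊆V₀ V₀∅) }

  extend : ∀ {V₀ v S} → v ∈ V₀ → Orientation (V₀ - v) → OutSet V₀ v S → Orientation V₀
  extend {V₀} {v} {S} v∈V₀ O O₊ = record
    { out = out ; rank = rank ; ascending = ascending ; spans = spans ; covers = covers }
    where
    module O = Orientation O
    module O₊ = OutSet O₊

    out : Digraph n
    out = updateAt O.out v (λ _ → S)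

    rank : Fin n → ℕ
    rank = updateAt (suc ∘ O.rank) v (λ _ → 0)

    out-v : out v ≡ S
    out-v = updateAt-updates v O.out

    out-u : ∀ {u} → u ≢ v → out u ≡ O.out u
    out-u u≢v = updateAt-minimal _ v O.out u≢v

    rank-v : rank v ≡ 0
    rank-v = updateAt-updates v (suc ∘ O.rank)

    rank-u : ∀ {u} → u ≢ v → rank u ≡ suc (O.rank u)
    rank-u u≢v = updateAt-minimal _ v (suc ∘ O.rank) u≢v

    ascending : ∀ {u w} → u ∈ V₀ → w ∈ out u → w ∈ V₀ × rank u < rank w
    ascending {u} {w} u∈V₀ w∈out with u ≟ v
    ... | yes refl = x∈p-y⇒x∈p w∈V₀-v , subst₂ _<_ (sym rank-v) (sym (rank-u (x∈p-y⇒x≢y w∈V₀-v))) (s≤s z≤n)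
      where
      w∈V₀-v : w ∈ V₀ - v
      w∈V₀-v = O₊.⊆-rest (subst (w ∈_) out-v w∈out)
    ... | no u≢v with O.ascending (x∈p∧x≢y⇒x∈p-y u∈V₀ u≢v) (subst (w ∈_) (out-u u≢v) w∈out)
    ... | w∈V₀-v , O-rank< =
      x∈p-y⇒x∈p w∈V₀-v , subst₂ _<_ (sym (rank-u u≢v)) (sym (rank-u (x∈p-y⇒x≢y w∈V₀-v))) (s≤s O-rank<)

    spans : ∀ {u} → u ∈ V₀ → Spans u (out u)
    spans {u} u∈V₀ with u ≟ v
    ... | yes refl = subst (Spans v) (sym out-v) O₊.spans
    ... | no u≢v   = subst (Spans u) (sym (out-u u≢v)) (O.spans (x∈p∧x≢y⇒x∈p-y u∈V₀ u≢v))

    covers : ∀ {e} → e ∈ₗ edges G → e ⊆ V₀ → HyperDAGEdge out e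
    covers {e} e∈G e⊆V₀ with v ∈? e
    ... | yes v∈e with O₊.covers (e∈G , e⊆V₀ , v∈e)
    ... | S≠∅ , e≡ = hyperDAGEdge v out-v S≠∅ e≡
    covers {e} e∈G e⊆V₀ | no v∉e
      with O.covers e∈G (λ x∈e → x∈p∧x≢y⇒x∈p-y (e⊆V₀ x∈e) (λ { refl → v∉e x∈e }))
    ... | u , S≠∅ , e≡ = hyperDAGEdge u (out-u u≢v) S≠∅ e≡
      where
      u≢v : u ≢ v
      u≢v refl = v∉e (subst (u ∈_) (sym e≡) (x∈⁅x⁆∪p u))

  outSet : ∀ {V₀ v} → inducedDegree G V₀ v ≤ 1 → ∃ (OutSet V₀ v)
  outSet {V₀} {v} deg≤1 =
    fromIncident (inducedIncident G V₀ v) deg≤1 (∈-inducedIncident⁻ G) (∈-inducedIncident⁺ G)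
    where
    fromIncident : ∀ es → length es ≤ 1 →
                   (∀ {e} → e ∈ₗ es → InducedIncident G V₀ v e) →
                   (∀ {e} → InducedIncident G V₀ v e → e ∈ₗ es) → ∃ (OutSet V₀ v)
    fromIncident [] _ _ complete = ⊥ , record
      { ⊆-rest = λ x∈⊥ → ⊥-elim (∉⊥ x∈⊥)
      ; spans  = inj₁ (λ (_ , x∈⊥) → ∉⊥ x∈⊥)
      ; covers = λ incident → case complete incident of λ () }
    fromIncident (e ∷ []) _ sound complete with sound (here refl)
    ... | e∈G , e⊆V₀ , v∈e = e - v , record
      { ⊆-rest = λ x∈e-v → x∈p∧x≢y⇒x∈p-y (e⊆V₀ (x∈p-y⇒x∈p x∈e-v)) (x∈p-y⇒x≢y x∈e-v)
      ; spans  = inj₂ (subst (_∈ₗ edges G) (sym (⁅x⁆∪p-x≡p v∈e)) e∈G)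
      ; covers = onlyE }
      where
      onlyE : ∀ {e′} → InducedIncident G V₀ v e′ → Nonempty (e - v) × e′ ≡ ⁅ v ⁆ ∪ (e - v)
      onlyE incident with complete incident
      ... | here refl = 2≤∣p∣⇒Nonempty[p-x] v (All.lookup (size≥2 G) e∈G) , sym (⁅x⁆∪p-x≡p v∈e)
    fromIncident (_ ∷ _ ∷ _) (s≤s ()) _ _

  module _ (degenerate : Degenerate 1 G) where

    orient : ∀ V₀ → Acc _⊂_ V₀ → Orientation V₀
    orient V₀ (acc smaller) with nonempty? V₀
    ... | no V₀∅ = orientEmpty V₀∅
    ... | yes V₀≠∅ with degenerate V₀ V₀≠∅
    ... | v , v∈V₀ , deg≤1 =
      extend v∈V₀ (orient (V₀ - v) (smaller (x∈p⇒p-x⊂p v∈V₀))) (proj₂ (outSet deg≤1))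

  orientation⇒hyperDAG : Orientation ⊤ → IsHyperDAG G
  orientation⇒hyperDAG O = out , acyclic , λ e → mk⇔ (λ e∈G → covers e∈G (λ _ → ∈⊤)) spanned
    where
    open Orientation O
    acyclic : IsDAG out
    acyclic = ranked⇒IsDAG rank (λ u→w → proj₂ (ascending ∈⊤ u→w))
    spanned : ∀ {e} → HyperDAGEdge out e → e ∈ₗ edges G
    spanned (u , out≠∅ , refl) with spans {u} ∈⊤
    ... | inj₁ out∅ = ⊥-elim (out∅ out≠∅)
    ... | inj₂ e∈G  = e∈G

1-degenerate⇒hyperDAG : (G : Hypergraph n) → Degenerate 1 G → IsHyperDAG G
1-degenerate⇒hyperDAG G degenerate =
  orientation⇒hyperDAG (orient degenerate ⊤ (⊂-wellFounded ⊤))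
  where open Orientations G

lemmaB1 : {n : ℕ} (G : Hypergraph n) →
    IsHyperDAG G ⇔
      ((V₀ : Subset n) → Nonempty V₀ → Σ _ λ v → v ∈ V₀ × inducedDegree G V₀ v ≤ 1)
lemmaB1 G = mk⇔ (hyperDAG⇒1-degenerate G) (1-degenerate⇒hyperDAG G)
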